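{- Let $M=\langle(W,\preccurlyeq),V\rangle$ be an intuitionistic model, let $T\subseteq\mathbb{P}$, and let $w\in W$ satisfy: (1) ${\preccurlyeq}(w)$ has a unique maximal world $u$; (2) $V(v)=T$ for all $v\in{\prec}(w)$. Then there exist an $\mathrm{HT}$ model $M'=\langle(\{0,1\},\preccurlyeq'),V'\rangle$ and a bisimulation $Z\subseteq W\times\{0,1\}$ such that $w\,Z\,0$.
   Context: An intuitionistic model over a countable set $\mathbb{P}$ of atoms is $\langle(W,\preccurlyeq),V\rangle$ with $W\ne\emptyset$, $\preccurlyeq$ a partial order, and $V:W\to2^{\mathbb{P}}$ monotone ($w\preccurlyeq v\Rightarrow V(w)\subseteq V(v)$). Define ${\preccurlyeq}(w):=\{v\in W\mid w\preccurlyeq v\}$ and ${\prec}(w):=\{v\in W\mid w\preccurlyeq v,\ v\ne w\}$. A world $u$ is maximal if there is no $v\ne u$ with $u\preccurlyeq v$. An $\mathrm{HT}$ model is an intuitionistic model on the frame $(\{0,1\},\preccurlyeq')$ with ${\preccurlyeq'}=\{(0,0),(1,1),(0,1)\}$. A bisimulation between models $\langle(W_1,\preccurlyeq_1),V_1\rangle$ and $\langle(W_2,\preccurlyeq_2),V_2\rangle$ is a relation $Z\subseteq W_1\times W_2$ such that whenever $w_1Zw_2$: - $V_1(w_1)=V_2(w_2)$; - for every $v_1\succcurlyeq_1w_1$, there is $v_2\succcurlyeq_2w_2$ with $v_1Zv_2$; - for every $v_2\succcurlyeq_2w_2$, there is $v_1\succcurlyeq_1w_1$ with $v_1Zv_2$.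 -}

module Defs where

open import Level using (Level; _⊔_; 0ℓ) renaming (suc to lsuc)
open import Data.Nat using (ℕ)
open import Data.Fin using (Fin; zero; suc)
open import Data.Product using (Σ; ∃; ∃-syntax; _×_; _,_)
open import Relation.Unary using (Pred; _⊆_; _≐_)
open import Relation.Binary using (Rel; IsPartialOrder)
open import Relation.Binary.PropositionalEquality using (_≡_; _≢_; refl; isEquivalence; cong; subst)
open import Relation.Nullary using (¬_)

-- Atoms: the countable set ℙ is ℕ.  A set of atoms is a predicate on ℕ.

record IntModel (a r v : Level) : Set (lsuc (a ⊔ r ⊔ v)) where
  field
    W      : Set a
    _≼_    : Rel W r
    isPO   : IsPartialOrder _≡_ _≼_
    V      : W → Pred ℕ v
    mono   : ∀ {x y} → x ≼ y → V x ⊆ V y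

open IntModel public

Up : ∀ {a r v} (M : IntModel a r v) → W M → W M → Set r
Up M w x = _≼_ M w x

StrictUp : ∀ {a r v} (M : IntModel a r v) → W M → W M → Set (a ⊔ r)
StrictUp M w x = _≼_ M w x × x ≢ w

Maximal : ∀ {a r v} (M : IntModel a r v) → W M → Set (a ⊔ r)
Maximal M u = ∀ x → _≼_ M u x → x ≡ u

MaximalIn↑ : ∀ {a r v} (M : IntModel a r v) → W M → W M → Set (a ⊔ r)
MaximalIn↑ M w u = Up M w u × (∀ x → Up M w x → _≼_ M u x → x ≡ u)

UniqueMaxIn↑ : ∀ {a r v} (M : IntModel a r v) → W M → W M → Set (a ⊔ r)
UniqueMaxIn↑ M w u = MaximalIn↑ M w u × (∀ u' → MaximalIn↑ M w u' → u' ≡ u)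

data _≼HT_ : Fin 2 → Fin 2 → Set where
  0≼0 : zero ≼HT zero
  1≼1 : suc zero ≼HT suc zero
  0≼1 : zero ≼HT suc zero

private
  ≼HT-refl : ∀ {i j : Fin 2} → i ≡ j → i ≼HT j
  ≼HT-refl {zero} refl = 0≼0
  ≼HT-refl {suc zero} refl = 1≼1

  ≼HT-trans : ∀ {i j k : Fin 2} → i ≼HT j → j ≼HT k → i ≼HT k
  ≼HT-trans 0≼0 q = q
  ≼HT-trans 1≼1 q = q
  ≼HT-trans 0≼1 1≼1 = 0≼1

  ≼HT-antisym : ∀ {i j : Fin 2} → i ≼HT j → j ≼HT i → i ≡ j
  ≼HT-antisym 0≼0 _ = refl
  ≼HT-antisym 1≼1 _ = refl
  ≼HT-antisym 0≼1 ()

≼HT-isPO : IsPartialOrder _≡_ _≼HT_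
≼HT-isPO = record
  { isPreorder = record
    { isEquivalence = isEquivalence
    ; reflexive = ≼HT-refl
    ; trans = ≼HT-trans }
  ; antisym = ≼HT-antisym }

HTModel : ∀ {v} (V' : Fin 2 → Pred ℕ v) → (∀ {i j} → i ≼HT j → V' i ⊆ V' j) → IntModel 0ℓ 0ℓ v
HTModel V' mono' = record
  { W = Fin 2 ; _≼_ = _≼HT_ ; isPO = ≼HT-isPO ; V = V' ; mono = mono' }

IsBisimulation : ∀ {a₁ r₁ a₂ r₂ v z} (M₁ : IntModel a₁ r₁ v) (M₂ : IntModel a₂ r₂ v)
                 → (Z : W M₁ → W M₂ → Set z) → Set (a₁ ⊔ r₁ ⊔ a₂ ⊔ r₂ ⊔ v ⊔ z)
IsBisimulation M₁ M₂ Z =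
  ∀ w₁ w₂ → Z w₁ w₂ →
      (V M₁ w₁ ≐ V M₂ w₂)
    × (∀ v₁ → _≼_ M₁ w₁ v₁ → ∃[ v₂ ] (_≼_ M₂ w₂ v₂ × Z v₁ v₂))
    × (∀ v₂ → _≼_ M₂ w₂ v₂ → ∃[ v₁ ] (_≼_ M₁ w₁ v₁ × Z v₁ v₂))

{-# OPTIONS --safe #-}
module Submission where

open import Defs
open import Level using (_⊔_; Lift; lift; lower)
open import Data.Nat using (ℕ)
open import Data.Fin using (Fin; zero; suc)
open import Data.Product using (Σ; ∃-syntax; _×_; _,_)
open import Data.Sum using (_⊎_; inj₁; inj₂)
open import Relation.Unary using (Pred; _⊆_; _≐_)
open import Relation.Unary.Properties using (≐-refl; ≐-sym; ≐-trans)
open import Relation.Nullary using (yes; no)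
open import Relation.Nullary.Decidable using (map′)
open import Relation.Binary using (Rel; IsPartialOrder)
open import Relation.Binary.PropositionalEquality using (_≡_; _≢_; refl)
open import Axiom.ExcludedMiddle using (ExcludedMiddle)

-- Above w only two valuations occur: V w itself, and the common valuation T
-- of the strict successors, which is also that of the maximal world u (if
-- u = w, then w is the only world above itself).  So the cone of w collapses
-- onto the HT frame: w goes to 0, and every world above w carrying the
-- valuation of u goes to 1.

module _ {a r v} (M : IntModel a r v) where

  open IsPartialOrder (isPO M) using (antisym) renaming (refl to ≤-refl; trans to ≤-trans)

  private
    _≤_ : Rel (W M) r
    _≤_ = _≼_ M

  -- Only the maximality of u in ≼(w) is used, not its uniqueness.
  strictUp-valuation≐max : ∀ {w u} (T : Pred ℕ v) → MaximalIn↑ M w u →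
                           (∀ x → StrictUp M w x → V M x ≐ T) →
                           ∀ x → StrictUp M w x → V M x ≐ V M u
  strictUp-valuation≐max {w} {u} T (w≤u , u-max) V≐T x (w≤x , x≢w) =
    ≐-trans (V≐T x (w≤x , x≢w)) (≐-sym (V≐T u (w≤u , u≢w)))
    where
    u≢w : u ≢ w
    u≢w refl = x≢w (u-max x w≤x w≤x)

  up-dichotomy : ∀ {w u} → ExcludedMiddle (a ⊔ r ⊔ v) →
                 (∀ x → StrictUp M w x → V M x ≐ V M u) →
                 ∀ x → w ≤ x → x ≡ w ⊎ V M x ≐ V M u
  up-dichotomy {w} em V≐Vu x w≤x
    with map′ lower lift (em {Lift (r ⊔ v) (x ≡ w)})
  ... | yes x≡w = inj₁ x≡w
  ... | no  x≢w = inj₂ (V≐Vu x (w≤x , x≢w))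

  module HTCollapse {w u : W M} (w≤u : w ≤ u)
                    (dichotomy : ∀ x → w ≤ x → x ≡ w ⊎ V M x ≐ V M u) where

    V′ : Fin 2 → Pred ℕ v
    V′ zero    = V M w
    V′ (suc _) = V M u

    V′-mono : ∀ {i j} → i ≼HT j → V′ i ⊆ V′ j
    V′-mono 0≼0 = λ p → p
    V′-mono 1≼1 = λ p → p
    V′-mono 0≼1 = mono M w≤u

    Z : W M → Fin 2 → Set (a ⊔ r ⊔ v)
    Z x zero    = Lift (r ⊔ v) (x ≡ w)
    Z x (suc _) = Lift a (w ≤ x × V M x ≐ V M u)

    valuation≐max-upward : ∀ {x y} → w ≤ x → V M x ≐ V M u → x ≤ y → V M y ≐ V M u
    valuation≐max-upward {x} {y} w≤x Vx≐Vu x≤y with dichotomy y (≤-trans w≤x x≤y)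
    ... | inj₂ Vy≐Vu = Vy≐Vu
    ... | inj₁ refl with antisym x≤y w≤x
    ...   | refl = Vx≐Vu

    isBisimulation : IsBisimulation M (HTModel V′ V′-mono) Z
    isBisimulation x zero (lift refl) = ≐-refl , forth , back
      where
      forth : ∀ y → x ≤ y → ∃[ j ] (zero ≼HT j × Z y j)
      forth y w≤y with dichotomy y w≤y
      ... | inj₁ y≡w   = zero , 0≼0 , lift y≡w
      ... | inj₂ Vy≐Vu = suc zero , 0≼1 , lift (w≤y , Vy≐Vu)

      back : ∀ j → zero ≼HT j → ∃[ y ] (x ≤ y × Z y j)
      back zero       0≼0 = w , ≤-refl , lift refl
      back (suc zero) 0≼1 = u , w≤u , lift (w≤u , ≐-refl)
    isBisimulation x (suc zero) (lift (w≤x , Vx≐Vu)) = Vx≐Vu , forth , back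
      where
      forth : ∀ y → x ≤ y → ∃[ j ] (suc zero ≼HT j × Z y j)
      forth y x≤y =
        suc zero , 1≼1 , lift (≤-trans w≤x x≤y , valuation≐max-upward w≤x Vx≐Vu x≤y)

      back : ∀ j → suc zero ≼HT j → ∃[ y ] (x ≤ y × Z y j)
      back (suc zero) 1≼1 = x , ≤-refl , lift (w≤x , Vx≐Vu)

lemma4 : ∀ {a r v} → ExcludedMiddle (a ⊔ r ⊔ v)
    → (M : IntModel a r v) (T : Pred ℕ v) (w : W M)
    → ∃[ u ] UniqueMaxIn↑ M w u
    → (∀ x → StrictUp M w x → V M x ≐ T)
    → Σ (Fin 2 → Pred ℕ v) λ V' →
    Σ (∀ {i j} → i ≼HT j → V' i ⊆ V' j) λ mono' →
    Σ (W M → Fin 2 → Set (a ⊔ r ⊔ v)) λ Z →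
    IsBisimulation M (HTModel V' mono') Z × Z w zero
lemma4 em M T w (u , u-max@(w≤u , _) , _) V≐T =
  V′ , V′-mono , Z , isBisimulation , lift refl
  where
  open HTCollapse M w≤u
    (up-dichotomy M em (strictUp-valuation≐max M T u-max V≐T))
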